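{- Let $(E,sim,ser)$ be a comtrace alphabet. If a step sequence $u\in\mathbb{S}^*$ is canonical and $u\equiv v$, then $\mathrm{length}(u)\le\mathrm{length}(v)$.
   Context: A comtrace alphabet is $(E,sim,ser)$ with $E$ finite, $sim\subseteq E\times E$ irreflexive and symmetric, $ser\subseteq sim$. Steps $\mathbb{S}$: nonempty $A\subseteq E$ with $(a,b)\in sim$ for all distinct $a,b\in A$. The comtrace congruence $\equiv$ on $\mathbb{S}^*$ is the reflexive symmetric transitive closure of the pairs $(wAz,wBCz)$ with $w,z\in\mathbb{S}^*$, $A,B,C\in\mathbb{S}$, $A=B\cup C$, $B\times C\subseteq ser$. $\mathrm{length}(A_1\dots A_k)=k$. The forward dependency $\mathbb{FD}\subseteq\mathbb{S}\times\mathbb{S}$ consists of pairs $(A,B)$ for which there is $C\in\mathbb{S}$ with $C\subseteq B$, $A\times C\subseteq ser$ and $C\times(B\setminus C)\subseteq ser$. A step sequence $A_1\dots A_k$ is canonical iff $(A_i,A_{i+1})\notin\mathbb{FD}$ for all $1\le i<k$. -}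

module Defs where

open import Data.Nat using (ℕ)
import Level
open import Data.Fin using (Fin)
open import Data.Fin.Subset using (Subset; _∈_; _⊆_; _∪_; _─_; Nonempty)
open import Data.List using (List; []; _∷_; _++_; length)
open import Data.Product using (Σ; _×_; _,_; ∃)
open import Relation.Binary.Core using (Rel)
open import Relation.Binary.Definitions using (Irreflexive; Symmetric; Decidable)
open import Relation.Binary.PropositionalEquality using (_≡_)
open import Relation.Binary.Construct.Closure.Equivalence using (EqClosure)
open import Relation.Nullary using (¬_)

-- A comtrace alphabet (E, sim, ser) with E finite, represented as E = Fin size.
-- sim, ser are binary relations on E (decidable, as subsets of the finite set E × E).
record ComtraceAlphabet : Set₁ where
  field
    size    : ℕ
    sim     : Rel (Fin size) Level.zero
    ser     : Rel (Fin size) Level.zero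
    sim-dec : Decidable sim
    ser-dec : Decidable ser
    sim-irr : Irreflexive _≡_ sim
    sim-sym : Symmetric sim
    ser⊆sim : ∀ {a b} → ser a b → sim a b

module _ (Θ : ComtraceAlphabet) where
  open ComtraceAlphabet Θ

  E : Set
  E = Fin size

  _×ₛ_⊆_ : Subset size → Subset size → Rel E Level.zero → Set
  X ×ₛ Y ⊆ R = ∀ a b → a ∈ X → b ∈ Y → R a b

  IsStep : Subset size → Set
  IsStep A = Nonempty A × (∀ a b → a ∈ A → b ∈ A → ¬ (a ≡ b) → sim a b)

  Step : Set
  Step = Σ (Subset size) IsStep

  set : Step → Subset size
  set (A , _) = A

  StepSeq : Set
  StepSeq = List Step

  data _⟶_ : Rel StepSeq Level.zero where
    split : ∀ (w z : StepSeq) (A B C : Step) →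
            set A ≡ set B ∪ set C →
            set B ×ₛ set C ⊆ ser →
            (w ++ A ∷ z) ⟶ (w ++ B ∷ C ∷ z)

  _≡ᶜ_ : Rel StepSeq Level.zero
  _≡ᶜ_ = EqClosure _⟶_

  FD : Step → Step → Set
  FD A B = Σ Step λ C → (set C ⊆ set B) × (set A ×ₛ set C ⊆ ser)
                        × (set C ×ₛ (set B ─ set C) ⊆ ser)

  data Canonical : StepSeq → Set where
    []  : Canonical []
    [_] : ∀ A → Canonical (A ∷ [])
    _∷_ : ∀ {A B u} → ¬ FD A B → Canonical (B ∷ u) → Canonical (A ∷ B ∷ u)

module Submission where

-- Call an occurrence a pair (i , a) with a ∈ A_i.  A *chain* in a step
-- sequence w is a walk through occurrences whose links are either
--   strong : (i , a) → (j , b) with i < j and ¬ ser a b, or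
--   weak   : (i , a) → (j , b) with i ≤ j and ¬ ser b a.
-- A chain with s strong links starting at position i forces s + i < length w.
-- (1) Chains survive comtrace equivalence: a single split wAz ⟶ wBCz, and its
--     inverse merge, relabel occurrences by an order-respecting embedding that
--     maps chains to chains with the same number of strong links.
-- (2) A canonical u = A₀ … Aₖ contains a chain with k strong links starting at
--     position 0.  Going backwards, if β ∈ A_{i+1} starts a chain, then
--     ¬ FD A_i A_{i+1} yields a ∈ A_i and c ∈ A_{i+1} with ¬ ser a c and a weak
--     path from c to β inside A_{i+1}: otherwise the weak-predecessor closure
--     of β inside A_{i+1} would be a step witnessing FD A_i A_{i+1}.
-- Hence if u ≡ v then v contains a chain with length u − 1 strong links, so
-- length u ≤ length v.

open import Defs
open import Level using (0ℓ)
open import Data.Nat using (ℕ; zero; suc; _+_; _≤_; _<_; z≤n; s≤s)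
open import Data.Nat.Properties
  using (≤-refl; ≤-trans; <-≤-trans; <⇒≤; ≤-pred; m≤n⇒m<n∨m≡n; m≤m+n; +-monoʳ-≤; +-monoʳ-<)
open import Data.List using ([]; _∷_; _++_; length)
open import Data.Fin using (Fin)
open import Data.Fin.Properties using (any?) renaming (_≟_ to _≟ᶠ_)
open import Data.Fin.Subset using (Subset; _∈_; _∉_; _─_; _-_; _∪_; _∩_; ∁; ⊤; ⊥; ⁅_⁆; ∣_∣; inside; outside)
open import Data.Fin.Subset.Properties
  using (_∈?_; ∉⊥; ∈⊤; x∈⁅x⁆; x∈p∪q⁻; x∈p∪q⁺; x∈p∩q⁺; x∈p∩q⁻; p∩q⊆p; p─q⊆p;
         x∈p∧x≢y⇒x∈p-y; x∈p⇒∣p-x∣<∣p∣; ∣p∣≤n; x∈∁p⇒x∉p; x∉p⇒x∈∁p)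
open import Data.Vec using (_∷_; here; there)
open import Data.Product using (Σ; _×_; _,_; proj₂)
open import Data.Sum using (_⊎_; inj₁; inj₂)
open import Data.Empty using (⊥-elim)
open import Relation.Nullary using (¬_; Dec; yes; no)
open import Relation.Nullary.Decidable using (_×-dec_; ¬?)
open import Relation.Binary.Core using (Rel)
open import Relation.Binary.Definitions using (Decidable)
open import Relation.Binary.PropositionalEquality using (_≡_; refl; sym; subst)
open import Relation.Binary.Construct.Closure.ReflexiveTransitive using (Star; ε; _◅_)
open import Relation.Binary.Construct.Closure.Symmetric using (fwd; bwd)

x∈p─q⇒x∉q : ∀ {n} {x : Fin n} (p q : Subset n) → x ∈ p ─ q → x ∉ q
x∈p─q⇒x∉q (s ∷ p) (outside ∷ q) here ()
x∈p─q⇒x∉q (s ∷ p) (outside ∷ q) (there x∈) (there x∈q) = x∈p─q⇒x∉q p q x∈ x∈q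
x∈p─q⇒x∉q (s ∷ p) (inside ∷ q) (there x∈) (there x∈q) = x∈p─q⇒x∉q p q x∈ x∈q

-- For a decidable relation on a finite set, the set of elements from which
-- β is reachable is computable: it contains β, each member reaches β, and it
-- is closed under predecessors.  It is found by shrinking the set R of
-- elements not yet known to reach β while some x ∈ R steps into the complement.
module Reach {n : ℕ} {_⟶_ : Rel (Fin n) 0ℓ} (_⟶?_ : Decidable _⟶_) (β : Fin n) where

  Sound : Subset n → Set
  Sound R = β ∉ R × (∀ {x} → x ∉ R → Star _⟶_ x β)

  Stable : Subset n → Set
  Stable R = ∀ {x y} → x ⟶ y → y ∉ R → x ∉ R

  exit? : ∀ R → Dec (Σ (Fin n) λ x → Σ (Fin n) λ y → x ∈ R × y ∉ R × x ⟶ y)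
  exit? R = any? λ x → any? λ y → (x ∈? R) ×-dec ¬? (y ∈? R) ×-dec (x ⟶? y)

  remove : ∀ {R x y} → Sound R → x ⟶ y → y ∉ R → Sound (R - x)
  remove {R} {x} (β∉R , reaches) x⟶y y∉R = β∉R-x , reaches′
    where
    β∉R-x : β ∉ R - x
    β∉R-x β∈ = β∉R (p─q⊆p R ⁅ x ⁆ β∈)
    reaches′ : ∀ {z} → z ∉ R - x → Star _⟶_ z β
    reaches′ {z} z∉ with z ≟ᶠ x
    ... | yes refl = x⟶y ◅ reaches y∉R
    ... | no z≢x = reaches (λ z∈R → z∉ (x∈p∧x≢y⇒x∈p-y z∈R z≢x))

  shrink : (k : ℕ) (R : Subset n) → ∣ R ∣ < k → Sound R → Σ (Subset n) λ R → Sound R × Stable R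
  shrink (suc k) R ∣R∣<k sound with exit? R
  ... | yes (x , y , x∈R , y∉R , x⟶y) =
        shrink k (R - x) (<-≤-trans (x∈p⇒∣p-x∣<∣p∣ x∈R) (≤-pred ∣R∣<k)) (remove sound x⟶y y∉R)
  ... | no no-exit = R , sound , λ {x} {y} x⟶y y∉R x∈R → no-exit (x , y , x∈R , y∉R , x⟶y)

  initial : Sound (⊤ - β)
  initial = (λ β∈ → x∈p─q⇒x∉q ⊤ ⁅ β ⁆ β∈ (x∈⁅x⁆ β)) , reaches
    where
    reaches : ∀ {x} → x ∉ ⊤ - β → Star _⟶_ x β
    reaches {x} x∉ with x ≟ᶠ β
    ... | yes refl = ε
    ... | no x≢β = ⊥-elim (x∉ (x∈p∧x≢y⇒x∈p-y ∈⊤ x≢β))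

  reachSet : Σ (Subset n) λ C → β ∈ C × (∀ {x} → x ∈ C → Star _⟶_ x β)
                                   × (∀ {x y} → x ⟶ y → y ∈ C → x ∈ C)
  reachSet with shrink (suc n) (⊤ - β) (s≤s (∣p∣≤n (⊤ - β))) initial
  ... | R , (β∉R , reaches) , stable =
        ∁ R , x∉p⇒x∈∁p β∉R , (λ x∈ → reaches (x∈∁p⇒x∉p x∈))
            , (λ x⟶y y∈ → x∉p⇒x∈∁p (stable x⟶y (x∈∁p⇒x∉p y∈)))

module Chains (Θ : ComtraceAlphabet) where
  open ComtraceAlphabet Θ

  El : Set
  El = Fin size

  -- the set of events at position i of w (empty beyond the end)
  occ : StepSeq Θ → ℕ → Subset size
  occ [] i = ⊥
  occ (X ∷ w) zero = set Θ X
  occ (X ∷ w) (suc i) = occ w i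

  occ-bound : ∀ w k {c} → c ∈ occ w k → k < length w
  occ-bound [] k c∈ = ⊥-elim (∉⊥ c∈)
  occ-bound (X ∷ w) zero _ = s≤s z≤n
  occ-bound (X ∷ w) (suc k) c∈ = s≤s (occ-bound w k c∈)

  data Chain (w : StepSeq Θ) : ℕ → El → ℕ → Set where
    end    : ∀ {i a} → a ∈ occ w i → Chain w i a 0
    strong : ∀ {i j a b s} → a ∈ occ w i → i < j → ¬ ser a b → Chain w j b s → Chain w i a (suc s)
    weak   : ∀ {i j a b s} → a ∈ occ w i → i ≤ j → ¬ ser b a → Chain w j b s → Chain w i a s

  chain-head : ∀ {w i a s} → Chain w i a s → a ∈ occ w i
  chain-head (end a∈) = a∈
  chain-head (strong a∈ _ _ _) = a∈
  chain-head (weak a∈ _ _ _) = a∈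

  -- each strong link advances the position, and the chain stays inside w
  chain-span : ∀ {w i a s} → Chain w i a s → s + i < length w
  chain-span {w} {i} (end a∈) = occ-bound w i a∈
  chain-span {s = suc s} (strong _ i<j _ ch) = ≤-trans (s≤s (+-monoʳ-< s i<j)) (chain-span ch)
  chain-span {s = s} (weak _ i≤j _ ch) = ≤-trans (s≤s (+-monoʳ-≤ s i≤j)) (chain-span ch)

  Chained : StepSeq Θ → ℕ → Set
  Chained w s = Σ ℕ λ i → Σ El λ a → Chain w i a s

  Chained⇒< : ∀ {w s} → Chained w s → s < length w
  Chained⇒< {s = s} (i , _ , ch) = ≤-trans (s≤s (m≤m+n s i)) (chain-span ch)

  record Embedding (w w' : StepSeq Θ) : Set where
    field
      pos    : ℕ → El → ℕ
      mem    : ∀ {i a} → a ∈ occ w i → a ∈ occ w' (pos i a)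
      pos-strong : ∀ {i j a b} → a ∈ occ w i → b ∈ occ w j → i < j → ¬ ser a b → pos i a < pos j b
      pos-weak   : ∀ {i j a b} → a ∈ occ w i → b ∈ occ w j → i ≤ j → ¬ ser b a → pos i a ≤ pos j b

  embed-chain : ∀ {w w'} (F : Embedding w w') {i a s} → Chain w i a s → Chain w' (Embedding.pos F i a) a s
  embed-chain F (end a∈) = end (Embedding.mem F a∈)
  embed-chain F (strong a∈ lt ns ch) =
    strong (Embedding.mem F a∈) (Embedding.pos-strong F a∈ (chain-head ch) lt ns) ns (embed-chain F ch)
  embed-chain F (weak a∈ le ns ch) =
    weak (Embedding.mem F a∈) (Embedding.pos-weak F a∈ (chain-head ch) le ns) ns (embed-chain F ch)

  embed-Chained : ∀ {w w' s} → Embedding w w' → Chained w s → Chained w' s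
  embed-Chained F (i , a , ch) = _ , a , embed-chain F ch

  module SplitMerge (z : StepSeq Θ) (A B C : Step Θ) (A=B∪C : set Θ A ≡ set Θ B ∪ set Θ C)
                    (B×C⊆ser : _×ₛ_⊆_ Θ (set Θ B) (set Θ C) ser) where

    fromA : ∀ {a} → a ∈ set Θ A → a ∈ set Θ B ⊎ a ∈ set Θ C
    fromA {a} a∈ = x∈p∪q⁻ (set Θ B) (set Θ C) (subst (a ∈_) A=B∪C a∈)

    toA : ∀ {a} → a ∈ set Θ B ⊎ a ∈ set Θ C → a ∈ set Θ A
    toA {a} a∈ = subst (a ∈_) (sym A=B∪C) (x∈p∪q⁺ a∈)

    -- offset of an event of A after the split: 0 if it goes to B, 1 otherwise
    side : El → ℕ
    side a with a ∈? set Θ B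
    ... | yes _ = 0
    ... | no _ = 1

    side≤1 : ∀ a → side a ≤ 1
    side≤1 a with a ∈? set Θ B
    ... | yes _ = z≤n
    ... | no _ = s≤s z≤n

    -- within A, a weak link (¬ ser b a) is never split as b ∈ B, a ∈ C
    side-weak : ∀ {a b} → a ∈ set Θ A → ¬ ser b a → side a ≤ side b
    side-weak {a} {b} a∈A ns with a ∈? set Θ B | b ∈? set Θ B
    ... | yes _ | _ = z≤n
    ... | no _ | no _ = ≤-refl
    ... | no a∉B | yes b∈B with fromA a∈A
    ...   | inj₁ a∈B = ⊥-elim (a∉B a∈B)
    ...   | inj₂ a∈C = ⊥-elim (ns (B×C⊆ser b a b∈B a∈C))

    side-mem : ∀ {a} → a ∈ set Θ A → a ∈ occ (B ∷ C ∷ z) (side a)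
    side-mem {a} a∈A with a ∈? set Θ B
    ... | yes a∈B = a∈B
    ... | no a∉B with fromA a∈A
    ...   | inj₁ a∈B = ⊥-elim (a∉B a∈B)
    ...   | inj₂ a∈C = a∈C

    -- position map for w ++ A ∷ z → w ++ B ∷ C ∷ z (recursion on the prefix w);
    -- strictly monotone in the position, so strong links are respected for free
    splitPos : StepSeq Θ → ℕ → El → ℕ
    splitPos [] zero a = side a
    splitPos [] (suc i) a = suc (suc i)
    splitPos (X ∷ w) zero a = zero
    splitPos (X ∷ w) (suc i) a = suc (splitPos w i a)

    splitPos-< : ∀ w {i j a b} → i < j → splitPos w i a < splitPos w j b
    splitPos-< [] {zero} {suc j} {a} _ = s≤s (≤-trans (side≤1 a) (s≤s z≤n))
    splitPos-< [] {suc i} {suc j} (s≤s i<j) = s≤s (s≤s i<j)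
    splitPos-< (X ∷ w) {zero} {suc j} _ = s≤s z≤n
    splitPos-< (X ∷ w) {suc i} {suc j} (s≤s i<j) = s≤s (splitPos-< w i<j)

    splitPos-weak : ∀ w {i a b} → a ∈ occ (w ++ A ∷ z) i → ¬ ser b a → splitPos w i a ≤ splitPos w i b
    splitPos-weak [] {zero} a∈ ns = side-weak a∈ ns
    splitPos-weak [] {suc i} _ _ = ≤-refl
    splitPos-weak (X ∷ w) {zero} _ _ = z≤n
    splitPos-weak (X ∷ w) {suc i} a∈ ns = s≤s (splitPos-weak w a∈ ns)

    splitPos-mem : ∀ w {i a} → a ∈ occ (w ++ A ∷ z) i → a ∈ occ (w ++ B ∷ C ∷ z) (splitPos w i a)
    splitPos-mem [] {zero} a∈ = side-mem a∈
    splitPos-mem [] {suc i} a∈ = a∈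
    splitPos-mem (X ∷ w) {zero} a∈ = a∈
    splitPos-mem (X ∷ w) {suc i} a∈ = splitPos-mem w a∈

    splitEmbedding : ∀ w → Embedding (w ++ A ∷ z) (w ++ B ∷ C ∷ z)
    splitEmbedding w = record
      { pos = splitPos w
      ; mem = splitPos-mem w
      ; pos-strong = λ _ _ lt _ → splitPos-< w lt
      ; pos-weak = weak′ }
      where
      weak′ : ∀ {i j a b} → a ∈ occ (w ++ A ∷ z) i → b ∈ occ (w ++ A ∷ z) j → i ≤ j → ¬ ser b a →
              splitPos w i a ≤ splitPos w j b
      weak′ a∈ _ i≤j ns with m≤n⇒m<n∨m≡n i≤j
      ... | inj₁ i<j = <⇒≤ (splitPos-< w i<j)
      ... | inj₂ refl = splitPos-weak w a∈ ns

    -- position map for w ++ B ∷ C ∷ z → w ++ A ∷ z: B and C both go to A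
    mergePos : StepSeq Θ → ℕ → ℕ
    mergePos [] zero = zero
    mergePos [] (suc i) = i
    mergePos (X ∷ w) zero = zero
    mergePos (X ∷ w) (suc i) = suc (mergePos w i)

    mergePos-mem : ∀ w {i a} → a ∈ occ (w ++ B ∷ C ∷ z) i → a ∈ occ (w ++ A ∷ z) (mergePos w i)
    mergePos-mem [] {zero} a∈ = toA (inj₁ a∈)
    mergePos-mem [] {suc zero} a∈ = toA (inj₂ a∈)
    mergePos-mem [] {suc (suc i)} a∈ = a∈
    mergePos-mem (X ∷ w) {zero} a∈ = a∈
    mergePos-mem (X ∷ w) {suc i} a∈ = mergePos-mem w a∈

    mergePos-≤ : ∀ w {i j} → i ≤ j → mergePos w i ≤ mergePos w j
    mergePos-≤ [] {zero} _ = z≤n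
    mergePos-≤ [] {suc i} {suc j} (s≤s i≤j) = i≤j
    mergePos-≤ (X ∷ w) {zero} _ = z≤n
    mergePos-≤ (X ∷ w) {suc i} {suc j} (s≤s i≤j) = s≤s (mergePos-≤ w i≤j)

    -- a strong link never goes from B to C, since B × C ⊆ ser
    mergePos-< : ∀ w {i j a b} → a ∈ occ (w ++ B ∷ C ∷ z) i → b ∈ occ (w ++ B ∷ C ∷ z) j →
                 i < j → ¬ ser a b → mergePos w i < mergePos w j
    mergePos-< [] {zero} {suc zero} {a} {b} a∈ b∈ _ ns = ⊥-elim (ns (B×C⊆ser a b a∈ b∈))
    mergePos-< [] {zero} {suc (suc j)} _ _ _ _ = s≤s z≤n
    mergePos-< [] {suc i} {suc j} _ _ (s≤s i<j) _ = i<j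
    mergePos-< (X ∷ w) {zero} {suc j} _ _ _ _ = s≤s z≤n
    mergePos-< (X ∷ w) {suc i} {suc j} a∈ b∈ (s≤s i<j) ns = s≤s (mergePos-< w a∈ b∈ i<j ns)

    mergeEmbedding : ∀ w → Embedding (w ++ B ∷ C ∷ z) (w ++ A ∷ z)
    mergeEmbedding w = record
      { pos = λ i _ → mergePos w i
      ; mem = mergePos-mem w
      ; pos-strong = mergePos-< w
      ; pos-weak = λ _ _ le _ → mergePos-≤ w le }

  ≡ᶜ-Chained : ∀ {u v s} → _≡ᶜ_ Θ u v → Chained u s → Chained v s
  ≡ᶜ-Chained ε h = h
  ≡ᶜ-Chained (fwd (split w z A B C e sr) ◅ r) h = ≡ᶜ-Chained r (embed-Chained (SplitMerge.splitEmbedding z A B C e sr w) h)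
  ≡ᶜ-Chained (bwd (split w z A B C e sr) ◅ r) h = ≡ᶜ-Chained r (embed-Chained (SplitMerge.mergeEmbedding z A B C e sr w) h)

  WeakStep : Subset size → Rel El 0ℓ
  WeakStep Bs x y = y ∈ Bs × ¬ ser y x

  weakStep? : ∀ Bs → Decidable (WeakStep Bs)
  weakStep? Bs x y = (y ∈? Bs) ×-dec ¬? (ser-dec y x)

  prepend-path : ∀ {w i a b s} → a ∈ occ w i → Star (WeakStep (occ w i)) a b → Chain w i b s → Chain w i a s
  prepend-path a∈ ε ch = ch
  prepend-path a∈ ((x∈ , ns) ◅ path) ch = weak a∈ ≤-refl ns (prepend-path x∈ path ch)

  shift : ∀ {X w i a s} → Chain w i a s → Chain (X ∷ w) (suc i) a s
  shift (end a∈) = end a∈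
  shift (strong a∈ lt ns ch) = strong a∈ (s≤s lt) ns (shift ch)
  shift (weak a∈ le ns ch) = weak a∈ (s≤s le) ns (shift ch)

  ×⊈ser-witness : ∀ X Y → ¬ _×ₛ_⊆_ Θ X Y ser → Σ El λ a → Σ El λ c → a ∈ X × c ∈ Y × ¬ ser a c
  ×⊈ser-witness X Y X×Y⊈ser
    with any? (λ a → any? λ c → (a ∈? X) ×-dec (c ∈? Y) ×-dec ¬? (ser-dec a c))
  ... | yes (a , c , w) = a , c , w
  ... | no none = ⊥-elim (X×Y⊈ser X×Y⊆ser)
    where
    X×Y⊆ser : _×ₛ_⊆_ Θ X Y ser
    X×Y⊆ser a c a∈ c∈ with ser-dec a c
    ... | yes s = s
    ... | no ns = ⊥-elim (none (a , c , a∈ , c∈ , ns))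

  subStep : (B : Step Θ) (D : Subset size) {β : El} → β ∈ set Θ B → β ∈ D → Step Θ
  subStep B D β∈B β∈D =
    set Θ B ∩ D , (_ , x∈p∩q⁺ (β∈B , β∈D)) ,
    λ a b a∈ b∈ a≢b → proj₂ (proj₂ B) a b (p∩q⊆p _ _ a∈) (p∩q⊆p _ _ b∈) a≢b

  closed-cut : ∀ Bs D → (∀ {x y} → WeakStep Bs x y → y ∈ D → x ∈ D) →
               _×ₛ_⊆_ Θ (Bs ∩ D) (Bs ─ (Bs ∩ D)) ser
  closed-cut Bs D closed x y x∈ y∈ with ser-dec x y
  ... | yes s = s
  ... | no ns = ⊥-elim (x∈p─q⇒x∉q Bs (Bs ∩ D) y∈ (x∈p∩q⁺ (p─q⊆p Bs (Bs ∩ D) y∈ , y∈D)))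
    where
    y∈D : y ∈ D
    y∈D with x∈p∩q⁻ Bs D x∈
    ... | x∈Bs , x∈D = closed (x∈Bs , ns) x∈D

  ¬FD-link : ∀ (A B : Step Θ) {β} → β ∈ set Θ B → ¬ FD Θ A B →
             Σ El λ a → Σ El λ c → a ∈ set Θ A × c ∈ set Θ B × ¬ ser a c × Star (WeakStep (set Θ B)) c β
  ¬FD-link A B {β} β∈B ¬fd with Reach.reachSet (weakStep? (set Θ B)) β
  ... | D , β∈D , reaches , closed
    with ×⊈ser-witness (set Θ A) (set Θ B ∩ D)
           (λ A×D⊆ser → ¬fd (subStep B D β∈B β∈D , p∩q⊆p _ _ , A×D⊆ser , closed-cut (set Θ B) D closed))
  ... | a , c , a∈A , c∈B∩D , ns with x∈p∩q⁻ (set Θ B) D c∈B∩D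
  ... | c∈B , c∈D = a , c , a∈A , c∈B , ns , reaches c∈D

  canonical-chain : ∀ (A : Step Θ) u → Canonical Θ (A ∷ u) → Σ El λ a → Chain (A ∷ u) 0 a (length u)
  canonical-chain (_ , (a , a∈A) , _) [] _ = a , end a∈A
  canonical-chain A (B ∷ u) (¬fd ∷ can) with canonical-chain B u can
  ... | β , ch with ¬FD-link A B (chain-head ch) ¬fd
  ...   | a , c , a∈A , c∈B , ns , path = a , strong a∈A (s≤s z≤n) ns (prepend-path c∈B path (shift ch))

lemma8p3 : (Θ : ComtraceAlphabet) (u v : StepSeq Θ) →
    Canonical Θ u → _≡ᶜ_ Θ u v → length u ≤ length v
lemma8p3 Θ [] v _ _ = z≤n
lemma8p3 Θ (A ∷ u) v can u≡v = Chained⇒< (≡ᶜ-Chained u≡v (0 , canonical-chain A u can))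
  where open Chains Θ
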